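{- Let $s=(s_0,\dots,s_{n-1})$ be a strong score sequence of length $n\ge1$. Then the $n$ multisets \[\mu(s+j)=\{s_0+j,s_1+j,\dots,s_{n-1}+j\},\qquad j\in\{0,1,\dots,n-1\},\] with elements in the cyclic group $\mathbb{Z}_n$, are all distinct.
   Context: A score sequence is the nondecreasing sequence of out-degrees of the vertices of a tournament; equivalently (Landau), integers $(s_0,\dots,s_{n-1})$ with $0\le s_0\le\cdots\le s_{n-1}\le n-1$, $s_0+\dots+s_{k-1}\ge\binom{k}{2}$ for $1\le k<n$, and $s_0+\dots+s_{n-1}=\binom n2$. A strong score sequence is a score sequence of length $n\ge1$ for which $s_0+\dots+s_{k-1}>\binom{k}{2}$ for all $1\le k<n$ (equivalently, it is the score sequence of a strongly connected tournament). -}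

module Defs where

open import Data.Nat using (ℕ; zero; suc; _+_; _*_; _≤_; _<_; _>_; NonZero)
open import Data.Nat.DivMod using (_mod_)
open import Data.Nat.Combinatorics using (_C_)
open import Data.Fin using (Fin; toℕ)
open import Data.Vec using (Vec; lookup; toList; map)
open import Data.List using (List)
open import Data.Nat.ListAction using (sum)
import Data.List as L
open import Data.Product using (_×_)
open import Relation.Binary.PropositionalEquality using (_≡_)

-- sum of the first k entries s_0 + ... + s_{k-1} of a vector (k ≤ n; for k > n it
-- is the sum of all entries, but it is only used with k ≤ n below)
prefixSum : ∀ {n} → Vec ℕ n → ℕ → ℕ
prefixSum s k = sum (L.take k (toList s))

Nondecreasing : ∀ {n} → Vec ℕ n → Set
Nondecreasing {n} s = ∀ (i j : Fin n) → toℕ i ≤ toℕ j → lookup s i ≤ lookup s j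

-- Landau's characterization of score sequences (as in the paper's context)
IsScoreSequence : ∀ {n} → Vec ℕ n → Set
IsScoreSequence {n} s =
  Nondecreasing s
  × (∀ (i : Fin n) → suc (lookup s i) ≤ n)
  × (∀ k → 1 ≤ k → k < n → k C 2 ≤ prefixSum s k)
  × prefixSum s n ≡ n C 2

IsStrongScoreSequence : ∀ {n} → Vec ℕ n → Set
IsStrongScoreSequence {n} s =
  1 ≤ n
  × IsScoreSequence s
  × (∀ k → 1 ≤ k → k < n → k C 2 < prefixSum s k)

-- the multiset μ(s+j) = {s_0+j, ..., s_{n-1}+j} with elements in ℤ_n,
-- represented as a list of elements of Fin n (multisets = lists up to permutation)
shiftMultiset : ∀ {n} .{{_ : NonZero n}} → Vec ℕ n → ℕ → List (Fin n)
shiftMultiset {n} s j = toList (map (λ x → (x + j) mod n) s)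

-- If μ(s+j) = μ(s+k) with j < k, then shifting back by j shows that the scores, read in ℤ_n,
-- form a multiset invariant under x ↦ x + d with d = k − j.  Put t = n − d.  Comparing Σ x with
-- Σ ((x + d) mod n) shows that exactly d scores are ≥ t; the rotation carries them onto the scores
-- < d, so (the sequence being sorted) the d smallest scores are exactly those < d, the t smallest
-- those < t, and s₀ + ⋯ + s_{d−1} = (sum of the scores ≥ t) − t·d.  Hence
--   C(n,2) = Σ s = (s₀ + ⋯ + s_{d−1}) + (s₀ + ⋯ + s_{t−1}) + d·t > C(d,2) + C(t,2) + d·t = C(n,2),
-- using the strict Landau inequalities at d and t.

module Submission where

open import Defs
open import Data.Empty using (⊥)
open import Data.Fin as Fin using (Fin; toℕ)
open import Data.Fin.Properties using (toℕ-fromℕ<)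
open import Data.List using (List; length; map; take; []; _∷_)
open import Data.List.Properties using (take-all; map-id; map-id-local; map-∘; map-cong; map-cong-local)
open import Data.List.Relation.Binary.Permutation.Propositional using (_↭_; ↭-sym)
open import Data.List.Relation.Binary.Permutation.Propositional.Properties using (map⁺)
open import Data.List.Relation.Unary.All as All using (All; _∷_; [])
open import Data.List.Relation.Unary.AllPairs using (AllPairs; _∷_; [])
open import Data.Nat using (ℕ; zero; suc; _+_; _*_; _∸_; _≤_; _<_; NonZero; z≤n; s≤s; _<?_)
open import Data.Nat.Combinatorics using (_C_; nC1≡n; nCk+nC[k+1]≡[n+1]C[k+1])
open import Data.Nat.DivMod using (_%_; _mod_; m<n⇒m%n≡m; [m+n]%n≡m%n; %-distribˡ-+; m%n%n≡m%n)
open import Data.Nat.ListAction using (sum)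
open import Data.Nat.ListAction.Properties using (sum-↭)
open import Data.Nat.Properties
open import Algebra.Properties.CommutativeSemigroup +-commutativeSemigroup using (interchange)
open import Data.Nat.Tactic.RingSolver using (solve-∀)
open import Data.Product using (_×_; _,_)
open import Data.Vec using (Vec; toList; _∷_; [])
open import Data.Vec.Properties using (toList-map; length-toList)
open import Data.Vec.Relation.Unary.All.Properties using (toList⁺; lookup⁻)
open import Function using (_∘_)
open import Relation.Binary using (tri<; tri≈; tri>)
open import Relation.Binary.PropositionalEquality
  using (_≡_; refl; sym; trans; cong; cong₂; subst; subst₂; module ≡-Reasoning)
open import Relation.Nullary using (¬_; yes; no; contradiction)

[_<_] : ℕ → ℕ → ℕ
[ x < t ] with x <? t
... | yes _ = 1
... | no  _ = 0

[_≤_] : ℕ → ℕ → ℕ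
[ t ≤ x ] with x <? t
... | yes _ = 0
... | no  _ = 1

module _ {x t : ℕ} where

  [<]-true : x < t → [ x < t ] ≡ 1
  [<]-true x<t with x <? t
  ... | yes _   = refl
  ... | no  x≮t = contradiction x<t x≮t

  [<]-false : t ≤ x → [ x < t ] ≡ 0
  [<]-false t≤x with x <? t
  ... | yes x<t = contradiction x<t (≤⇒≯ t≤x)
  ... | no  _   = refl

[<]+[≤]≡1 : ∀ x t → [ x < t ] + [ t ≤ x ] ≡ 1
[<]+[≤]≡1 x t with x <? t
... | yes _ = refl
... | no  _ = refl

[<]*x+[≤]*x≡x : ∀ x t → [ x < t ] * x + [ t ≤ x ] * x ≡ x
[<]*x+[≤]*x≡x x t = begin
  [ x < t ] * x + [ t ≤ x ] * x ≡⟨ *-distribʳ-+ x [ x < t ] [ t ≤ x ] ⟨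
  ([ x < t ] + [ t ≤ x ]) * x   ≡⟨ cong (_* x) ([<]+[≤]≡1 x t) ⟩
  1 * x                         ≡⟨ *-identityˡ x ⟩
  x                             ∎
  where open ≡-Reasoning

sum-map-+ : ∀ (f g : ℕ → ℕ) l → sum (map (λ x → f x + g x) l) ≡ sum (map f l) + sum (map g l)
sum-map-+ f g []       = refl
sum-map-+ f g (x ∷ xs) =
  trans (cong (f x + g x +_) (sum-map-+ f g xs)) (interchange (f x) (g x) _ _)

sum-map-*ˡ : ∀ c (f : ℕ → ℕ) l → sum (map (λ x → c * f x) l) ≡ c * sum (map f l)
sum-map-*ˡ c f []       = sym (*-zeroʳ c)
sum-map-*ˡ c f (x ∷ xs) =
  trans (cong (c * f x +_) (sum-map-*ˡ c f xs)) (sym (*-distribˡ-+ c (f x) _))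

sum-map-const : ∀ c (l : List ℕ) → sum (map (λ _ → c) l) ≡ length l * c
sum-map-const c []       = refl
sum-map-const c (x ∷ xs) = cong (c +_) (sum-map-const c xs)

sum-map-id : ∀ l → sum (map (λ x → x) l) ≡ sum l
sum-map-id l = cong sum (map-id l)

sum-map-↭ : ∀ (f : ℕ → ℕ) {xs ys} → xs ↭ ys → sum (map f xs) ≡ sum (map f ys)
sum-map-↭ f xs↭ys = sum-↭ (map⁺ f xs↭ys)

sum-map-cong : ∀ {f g : ℕ → ℕ} {l} → All (λ x → f x ≡ g x) l →
               sum (map f l) ≡ sum (map g l)
sum-map-cong f≡g = cong sum (map-cong-local f≡g)

module _ (u : ℕ) where

  count-<≡0×sum-<≡0 : ∀ {l} → All (u ≤_) l →
    sum (map (λ x → [ x < u ]) l) ≡ 0 × sum (map (λ x → [ x < u ] * x) l) ≡ 0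
  count-<≡0×sum-<≡0 []           = refl , refl
  count-<≡0×sum-<≡0 (u≤x ∷ u≤xs) with count-<≡0×sum-<≡0 u≤xs
  ... | count≡0 , sum≡0 rewrite [<]-false u≤x = count≡0 , sum≡0

  sorted⇒sum-<≡sum-take : ∀ {l} → AllPairs _≤_ l →
    sum (map (λ x → [ x < u ] * x) l) ≡ sum (take (sum (map (λ x → [ x < u ]) l)) l)
  sorted⇒sum-<≡sum-take {[]}     []             = refl
  sorted⇒sum-<≡sum-take {x ∷ xs} (x≤xs ∷ sorted) with x <? u
  ... | yes _   = cong₂ _+_ (*-identityˡ x) (sorted⇒sum-<≡sum-take sorted)
  ... | no  x≮u with count-<≡0×sum-<≡0 (All.map (≤-trans (≮⇒≥ x≮u)) x≤xs)
  ...   | count≡0 , sum≡0 rewrite count≡0 = sum≡0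

[1+m]C2≡m+mC2 : ∀ m → suc m C 2 ≡ m + m C 2
[1+m]C2≡m+mC2 m = trans (sym (nCk+nC[k+1]≡[n+1]C[k+1] m 1)) (cong (_+ m C 2) (nC1≡n m))

[m+n]C2≡mC2+nC2+m*n : ∀ m n → (m + n) C 2 ≡ m C 2 + n C 2 + m * n
[m+n]C2≡mC2+nC2+m*n m zero rewrite +-identityʳ m | *-zeroʳ m =
  sym (trans (+-identityʳ _) (+-identityʳ _))
[m+n]C2≡mC2+nC2+m*n m (suc n) = begin
  (m + suc n) C 2
    ≡⟨ cong (_C 2) (+-suc m n) ⟩
  suc (m + n) C 2
    ≡⟨ [1+m]C2≡m+mC2 (m + n) ⟩
  m + n + (m + n) C 2
    ≡⟨ cong (m + n +_) ([m+n]C2≡mC2+nC2+m*n m n) ⟩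
  m + n + (m C 2 + n C 2 + m * n)
    ≡⟨ rearrange m n (m C 2) (n C 2) (m * n) ⟩
  m C 2 + (n + n C 2) + (m + m * n)
    ≡⟨ cong₂ (λ a b → m C 2 + a + b) ([1+m]C2≡m+mC2 n) (*-suc m n) ⟨
  m C 2 + suc n C 2 + m * suc n
    ∎
  where
  open ≡-Reasoning
  rearrange : ∀ a b p q r → a + b + (p + q + r) ≡ p + (b + q) + (a + r)
  rearrange = solve-∀

rotate : (n : ℕ) .{{_ : NonZero n}} → ℕ → ℕ → ℕ
rotate n d x = (x + d) % n

module Rotation (n : ℕ) .{{_ : NonZero n}} {d t : ℕ} (d+t≡n : d + t ≡ n) where

  t+d≡n : t + d ≡ n
  t+d≡n = trans (+-comm t d) d+t≡n

  rotate-below : ∀ {x} → x < t → rotate n d x ≡ x + d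
  rotate-below x<t = m<n⇒m%n≡m (subst (_ <_) t+d≡n (+-monoˡ-< d x<t))

  rotate-above : ∀ {x} → t ≤ x → x < n → rotate n d x + t ≡ x
  rotate-above {x} t≤x x<n = begin
    (x + d) % n + t       ≡⟨ cong (λ z → (z + d) % n + t) x≡y+t ⟩
    (y + t + d) % n + t   ≡⟨ cong (λ z → z % n + t) (trans (+-assoc y t d) (cong (y +_) t+d≡n)) ⟩
    (y + n) % n + t       ≡⟨ cong (_+ t) ([m+n]%n≡m%n y n) ⟩
    y % n + t             ≡⟨ cong (_+ t) (m<n⇒m%n≡m (≤-<-trans (m∸n≤m x t) x<n)) ⟩
    y + t                 ≡⟨ x≡y+t ⟨
    x                     ∎
    where
    open ≡-Reasoning
    y = x ∸ t
    x≡y+t : x ≡ y + t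
    x≡y+t = sym (m∸n+n≡m t≤x)

  rotate-above-< : ∀ {x} → t ≤ x → x < n → rotate n d x < d
  rotate-above-< {x} t≤x x<n =
    +-cancelʳ-< t _ d (subst₂ _<_ (sym (rotate-above t≤x x<n)) (sym d+t≡n) x<n)

  rotate+n*[≤]≡x+d : ∀ {x} → x < n → rotate n d x + n * [ t ≤ x ] ≡ x + d
  rotate+n*[≤]≡x+d {x} x<n with x <? t
  ... | yes x<t = trans (cong₂ _+_ (rotate-below x<t) (*-zeroʳ n)) (+-identityʳ _)
  ... | no  x≮t = begin
    rotate n d x + n * 1   ≡⟨ cong (rotate n d x +_) (trans (*-identityʳ n) (sym t+d≡n)) ⟩
    rotate n d x + (t + d) ≡⟨ +-assoc (rotate n d x) t d ⟨
    rotate n d x + t + d   ≡⟨ cong (_+ d) (rotate-above (≮⇒≥ x≮t) x<n) ⟩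
    x + d                  ∎
    where open ≡-Reasoning

  [rotate<d]≡[t≤] : ∀ {x} → x < n → [ rotate n d x < d ] ≡ [ t ≤ x ]
  [rotate<d]≡[t≤] {x} x<n with x <? t
  ... | yes x<t = [<]-false (subst (d ≤_) (sym (rotate-below x<t)) (m≤n+m d x))
  ... | no  x≮t = [<]-true (rotate-above-< (≮⇒≥ x≮t) x<n)

  [rotate<d]*rotate+t*[≤]≡[≤]*x : ∀ {x} → x < n →
    [ rotate n d x < d ] * rotate n d x + t * [ t ≤ x ] ≡ [ t ≤ x ] * x
  [rotate<d]*rotate+t*[≤]≡[≤]*x {x} x<n rewrite [rotate<d]≡[t≤] x<n with x <? t
  ... | yes _   = *-zeroʳ t
  ... | no  x≮t = begin
    1 * rotate n d x + t * 1 ≡⟨ cong₂ _+_ (*-identityˡ _) (*-identityʳ t) ⟩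
    rotate n d x + t         ≡⟨ rotate-above (≮⇒≥ x≮t) x<n ⟩
    x                        ≡⟨ *-identityˡ x ⟨
    1 * x                    ∎
    where open ≡-Reasoning

  module Invariant {l : List ℕ} (l<n : All (_< n) l) (|l|≡n : length l ≡ n)
                   (l↭rotl : l ↭ map (rotate n d) l) where

    sum-map-rotate : ∀ f → sum (map f l) ≡ sum (map (f ∘ rotate n d) l)
    sum-map-rotate f = trans (sum-map-↭ f l↭rotl) (cong sum (sym (map-∘ l)))

    count-≥t : sum (map (λ x → [ t ≤ x ]) l) ≡ d
    count-≥t = *-cancelˡ-≡ _ d n (+-cancelˡ-≡ (sum l) _ _ (begin
      sum l + n * sum (map (λ x → [ t ≤ x ]) l)
        ≡⟨ cong₂ _+_ (trans (sym (sum-map-rotate (λ x → x))) (sum-map-id l))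
                     (sum-map-*ˡ n (λ x → [ t ≤ x ]) l) ⟨
      sum (map (rotate n d) l) + sum (map (λ x → n * [ t ≤ x ]) l)
        ≡⟨ sum-map-+ (rotate n d) (λ x → n * [ t ≤ x ]) l ⟨
      sum (map (λ x → rotate n d x + n * [ t ≤ x ]) l)
        ≡⟨ sum-map-cong (All.map rotate+n*[≤]≡x+d l<n) ⟩
      sum (map (λ x → x + d) l)
        ≡⟨ sum-map-+ (λ x → x) (λ _ → d) l ⟩
      sum (map (λ x → x) l) + sum (map (λ _ → d) l)
        ≡⟨ cong₂ _+_ (sum-map-id l) (trans (sum-map-const d l) (cong (_* d) |l|≡n)) ⟩
      sum l + n * d
        ∎))
      where open ≡-Reasoning

    count-<d : sum (map (λ x → [ x < d ]) l) ≡ d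
    count-<d = begin
      sum (map (λ x → [ x < d ]) l)             ≡⟨ sum-map-rotate (λ x → [ x < d ]) ⟩
      sum (map (λ x → [ rotate n d x < d ]) l) ≡⟨ sum-map-cong (All.map [rotate<d]≡[t≤] l<n) ⟩
      sum (map (λ x → [ t ≤ x ]) l)             ≡⟨ count-≥t ⟩
      d                                         ∎
      where open ≡-Reasoning

    count-<t : sum (map (λ x → [ x < t ]) l) ≡ t
    count-<t = +-cancelʳ-≡ d _ t (begin
      sum (map (λ x → [ x < t ]) l) + d
        ≡⟨ cong (_ +_) count-≥t ⟨
      sum (map (λ x → [ x < t ]) l) + sum (map (λ x → [ t ≤ x ]) l)
        ≡⟨ sum-map-+ (λ x → [ x < t ]) (λ x → [ t ≤ x ]) l ⟨
      sum (map (λ x → [ x < t ] + [ t ≤ x ]) l)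
        ≡⟨ cong sum (map-cong (λ x → [<]+[≤]≡1 x t) l) ⟩
      sum (map (λ _ → 1) l)
        ≡⟨ sum-map-const 1 l ⟩
      length l * 1
        ≡⟨ trans (*-identityʳ _) |l|≡n ⟩
      n
        ≡⟨ t+d≡n ⟨
      t + d
        ∎)
      where open ≡-Reasoning

    sum-<d+t*d≡sum-≥t :
      sum (map (λ x → [ x < d ] * x) l) + t * d ≡ sum (map (λ x → [ t ≤ x ] * x) l)
    sum-<d+t*d≡sum-≥t = begin
      sum (map (λ x → [ x < d ] * x) l) + t * d
        ≡⟨ cong₂ _+_ (sum-map-rotate (λ x → [ x < d ] * x)) (cong (t *_) (sym count-≥t)) ⟩
      sum (map (λ x → [ rotate n d x < d ] * rotate n d x) l) + t * sum (map (λ x → [ t ≤ x ]) l)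
        ≡⟨ cong (_ +_) (sum-map-*ˡ t (λ x → [ t ≤ x ]) l) ⟨
      sum (map (λ x → [ rotate n d x < d ] * rotate n d x) l) + sum (map (λ x → t * [ t ≤ x ]) l)
        ≡⟨ sum-map-+ _ _ l ⟨
      sum (map (λ x → [ rotate n d x < d ] * rotate n d x + t * [ t ≤ x ]) l)
        ≡⟨ sum-map-cong (All.map [rotate<d]*rotate+t*[≤]≡[≤]*x l<n) ⟩
      sum (map (λ x → [ t ≤ x ] * x) l)
        ∎
      where open ≡-Reasoning

    module _ (sorted : AllPairs _≤_ l) where

      sum-take≡sum-< : ∀ u → sum (map (λ x → [ x < u ]) l) ≡ u →
                           sum (take u l) ≡ sum (map (λ x → [ x < u ] * x) l)
      sum-take≡sum-< u count≡u =
        sym (trans (sorted⇒sum-<≡sum-take u sorted) (cong (λ m → sum (take m l)) count≡u))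

      sum≡sum-take-d+sum-take-t+d*t : sum l ≡ sum (take d l) + sum (take t l) + d * t
      sum≡sum-take-d+sum-take-t+d*t = begin
        sum l
          ≡⟨ sum-map-id l ⟨
        sum (map (λ x → x) l)
          ≡⟨ cong sum (map-cong (λ x → [<]*x+[≤]*x≡x x t) l) ⟨
        sum (map (λ x → [ x < t ] * x + [ t ≤ x ] * x) l)
          ≡⟨ sum-map-+ _ _ l ⟩
        sum (map (λ x → [ x < t ] * x) l) + sum (map (λ x → [ t ≤ x ] * x) l)
          ≡⟨ cong₂ _+_ (sum-take≡sum-< t count-<t) sum-<d+t*d≡sum-≥t ⟨
        sum (take t l) + (sum (map (λ x → [ x < d ] * x) l) + t * d)
          ≡⟨ cong (λ p → sum (take t l) + (p + t * d)) (sum-take≡sum-< d count-<d) ⟨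
        sum (take t l) + (sum (take d l) + t * d)
          ≡⟨ rearrange (sum (take t l)) (sum (take d l)) t d ⟩
        sum (take d l) + sum (take t l) + d * t
          ∎
        where
        open ≡-Reasoning
        rearrange : ∀ a b c e → a + (b + c * e) ≡ b + a + e * c
        rearrange = solve-∀

      ¬strict-prefix-bounds : sum l ≡ n C 2 → d C 2 < sum (take d l) → t C 2 < sum (take t l) → ⊥
      ¬strict-prefix-bounds sum≡nC2 d-strict t-strict = <-irrefl refl (subst₂ _<_ binomial total bound)
        where
        bound : d C 2 + t C 2 + d * t < sum (take d l) + sum (take t l) + d * t
        bound = +-monoˡ-< (d * t) (+-mono-< d-strict t-strict)
        binomial : d C 2 + t C 2 + d * t ≡ n C 2
        binomial = trans (sym ([m+n]C2≡mC2+nC2+m*n d t)) (cong (_C 2) d+t≡n)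
        total : sum (take d l) + sum (take t l) + d * t ≡ n C 2
        total = trans (sym sum≡sum-take-d+sum-take-t+d*t) sum≡nC2

nondecreasing⇒sorted : ∀ {m} (xs : Vec ℕ m) → Nondecreasing xs → AllPairs _≤_ (toList xs)
nondecreasing⇒sorted []       _  = []
nondecreasing⇒sorted (x ∷ xs) nd =
  toList⁺ (lookup⁻ (λ i → nd Fin.zero (Fin.suc i) z≤n))
  ∷ nondecreasing⇒sorted xs (λ i j → nd (Fin.suc i) (Fin.suc j) ∘ s≤s)

[m%n+k]%n≡[m+k]%n : ∀ m k n .{{_ : NonZero n}} → (m % n + k) % n ≡ (m + k) % n
[m%n+k]%n≡[m+k]%n m k n = begin
  (m % n + k) % n         ≡⟨ %-distribˡ-+ (m % n) k n ⟩
  (m % n % n + k % n) % n ≡⟨ cong (λ z → (z + k % n) % n) (m%n%n≡m%n m n) ⟩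
  (m % n + k % n) % n     ≡⟨ %-distribˡ-+ m k n ⟨
  (m + k) % n             ∎
  where open ≡-Reasoning

module _ (n : ℕ) .{{_ : NonZero n}} {j k : ℕ} (j<k : j < k) (k<n : k < n) where

  private
    unshift : Fin n → ℕ
    unshift y = (toℕ y + (n ∸ j)) % n

    j+[n∸j]≡n : j + (n ∸ j) ≡ n
    j+[n∸j]≡n = m+[n∸m]≡n (<⇒≤ (<-trans j<k k<n))

    map-unshift-shiftMultiset : ∀ m (s : Vec ℕ n) →
      map unshift (shiftMultiset s m) ≡ map (λ x → (x + (m + (n ∸ j))) % n) (toList s)
    map-unshift-shiftMultiset m s = begin
      map unshift (shiftMultiset s m)
        ≡⟨ cong (map unshift) (toList-map _ s) ⟩
      map unshift (map (λ x → (x + m) mod n) (toList s))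
        ≡⟨ map-∘ (toList s) ⟨
      map (unshift ∘ (λ x → (x + m) mod n)) (toList s)
        ≡⟨ map-cong unshift-shift (toList s) ⟩
      map (λ x → (x + (m + (n ∸ j))) % n) (toList s)
        ∎
      where
      open ≡-Reasoning
      unshift-shift : ∀ x → unshift ((x + m) mod n) ≡ (x + (m + (n ∸ j))) % n
      unshift-shift x = begin
        (toℕ ((x + m) mod n) + (n ∸ j)) % n ≡⟨ cong (λ z → (z + (n ∸ j)) % n) (toℕ-fromℕ< _) ⟩
        ((x + m) % n + (n ∸ j)) % n         ≡⟨ [m%n+k]%n≡[m+k]%n (x + m) (n ∸ j) n ⟩
        (x + m + (n ∸ j)) % n               ≡⟨ cong (_% n) (+-assoc x m (n ∸ j)) ⟩
        (x + (m + (n ∸ j))) % n             ∎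

  shift-invariant⇒rotation-invariant : (s : Vec ℕ n) → All (_< n) (toList s) →
    shiftMultiset s j ↭ shiftMultiset s k → toList s ↭ map (rotate n (k ∸ j)) (toList s)
  shift-invariant⇒rotation-invariant s s<n shifts↭ =
    subst₂ _↭_ unshift-j unshift-k (map⁺ unshift shifts↭)
    where
    open ≡-Reasoning
    unshift-j : map unshift (shiftMultiset s j) ≡ toList s
    unshift-j = trans (map-unshift-shiftMultiset j s) (map-id-local (All.map cancel s<n))
      where
      cancel : ∀ {x} → x < n → (x + (j + (n ∸ j))) % n ≡ x
      cancel {x} x<n = begin
        (x + (j + (n ∸ j))) % n ≡⟨ cong (λ z → (x + z) % n) j+[n∸j]≡n ⟩
        (x + n) % n             ≡⟨ [m+n]%n≡m%n x n ⟩
        x % n                   ≡⟨ m<n⇒m%n≡m x<n ⟩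
        x                       ∎
    unshift-k : map unshift (shiftMultiset s k) ≡ map (rotate n (k ∸ j)) (toList s)
    unshift-k = trans (map-unshift-shiftMultiset k s) (map-cong cancel (toList s))
      where
      d = k ∸ j
      k+[n∸j]≡d+n : k + (n ∸ j) ≡ d + n
      k+[n∸j]≡d+n = begin
        k + (n ∸ j)       ≡⟨ cong (_+ (n ∸ j)) (m∸n+n≡m (<⇒≤ j<k)) ⟨
        d + j + (n ∸ j)   ≡⟨ +-assoc d j (n ∸ j) ⟩
        d + (j + (n ∸ j)) ≡⟨ cong (d +_) j+[n∸j]≡n ⟩
        d + n             ∎
      cancel : ∀ x → (x + (k + (n ∸ j))) % n ≡ (x + d) % n
      cancel x = begin
        (x + (k + (n ∸ j))) % n ≡⟨ cong (λ z → (x + z) % n) k+[n∸j]≡d+n ⟩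
        (x + (d + n)) % n       ≡⟨ cong (_% n) (+-assoc x d n) ⟨
        (x + d + n) % n         ≡⟨ [m+n]%n≡m%n (x + d) n ⟩
        (x + d) % n             ∎

shifts-distinct-< : ∀ (n : ℕ) .{{_ : NonZero n}} (s : Vec ℕ n) → IsStrongScoreSequence s →
  ∀ {j k} → j < k → k < n → ¬ (shiftMultiset s j ↭ shiftMultiset s k)
shifts-distinct-< n s (_ , (nondecreasing , s<n , _ , sum≡nC2) , strict) {j} {k} j<k k<n shifts↭ =
  ¬strict-prefix-bounds (nondecreasing⇒sorted s nondecreasing) sum-s≡nC2
    (strict d 0<d d<n) (strict t 0<t t<n)
  where
  d = k ∸ j
  t = n ∸ d
  d<n : d < n
  d<n = ≤-<-trans (m∸n≤m k j) k<n
  0<d : 0 < d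
  0<d = m<n⇒0<n∸m j<k
  0<t : 0 < t
  0<t = m<n⇒0<n∸m d<n
  t<n : t < n
  t<n = ∸-monoʳ-< 0<d (<⇒≤ d<n)
  s<n′ : All (_< n) (toList s)
  s<n′ = toList⁺ (lookup⁻ s<n)
  sum-s≡nC2 : sum (toList s) ≡ n C 2
  sum-s≡nC2 = trans (cong sum (sym (take-all n _ (≤-reflexive (length-toList s))))) sum≡nC2
  open Rotation n {d} {t} (m+[n∸m]≡n (<⇒≤ d<n))
  open Invariant s<n′ (length-toList s) (shift-invariant⇒rotation-invariant n j<k k<n s s<n′ shifts↭)

lemma6 : ∀ (n : ℕ) .{{_ : NonZero n}} (s : Vec ℕ n) → IsStrongScoreSequence s →
           ∀ (j k : ℕ) → j < n → k < n →
           shiftMultiset s j ↭ shiftMultiset s k → j ≡ k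
lemma6 n s strong j k j<n k<n shifts↭ with <-cmp j k
... | tri< j<k _ _ = contradiction shifts↭ (shifts-distinct-< n s strong j<k k<n)
... | tri≈ _ j≡k _ = j≡k
... | tri> _ _ k<j = contradiction (↭-sym shifts↭) (shifts-distinct-< n s strong k<j j<n)
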